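{- If an abstract Krivine structure $\mathcal{K}=(\Lambda,\Pi,\ldots,\mathrm{PL},\perp\!\!\!\perp)$ is consistent (in the sense that $\Pi^{\perp\!\!\!\perp}\cap\mathrm{PL}=\varnothing$), then the induced implicative structure $\mathscr{A}=(\mathfrak{P}(\Pi),\supseteq,\to)$ is classically consistent, i.e. $t^{\mathscr{A}}\neq\Pi$ for every closed $\lambda$-term $t$ possibly containing the constant $\mathtt{cc}$.
   Context: An abstract Krivine structure is $\mathcal{K}=(\Lambda,\Pi,@,\cdot,\mathtt{k}_{\_},\mathtt{K},\mathtt{S},\mathtt{cc},\mathrm{PL},\perp\!\!\!\perp)$: nonempty sets $\Lambda$ (terms) and $\Pi$ (stacks), application $@:\Lambda^2\to\Lambda$ (written $tu$), push $\cdot:\Lambda\times\Pi\to\Pi$, $\mathtt{k}_{\_}:\Pi\to\Lambda$, distinguished $\mathtt{K},\mathtt{S},\mathtt{cc}\in\Lambda$, a set $\mathrm{PL}\subseteq\Lambda$ of proof-like terms containing $\mathtt{K},\mathtt{S},\mathtt{cc}$ and closed under application, and a pole $\perp\!\!\!\perp\subseteq\Lambda\times\Pi$ closed under anti-evaluation: $(t,u\cdot\pi)\in\perp\!\!\!\perp\Rightarrow(tu,\pi)\in\perp\!\!\!\perp$; $(t,\pi)\in\perp\!\!\!\perp\Rightarrow(\mathtt{K},t\cdot u\cdot\pi)\in\perp\!\!\!\perp$; $(t,v\cdot uv\cdot\pi)\in\perp\!\!\!\perp\Rightarrow(\mathtt{S},t\cdot u\cdot v\cdot\pi)\in\perp\!\!\!\perp$;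 $(t,\mathtt{k}_\pi\cdot\pi)\in\perp\!\!\!\perp\Rightarrow(\mathtt{cc},t\cdot\pi)\in\perp\!\!\!\perp$; $(t,\pi)\in\perp\!\!\!\perp\Rightarrow(\mathtt{k}_\pi,t\cdot\pi')\in\perp\!\!\!\perp$. For $a\subseteq\Pi$, $a^{\perp\!\!\!\perp}=\{t\in\Lambda:\forall\pi\in a,(t,\pi)\in\perp\!\!\!\perp\}$. The induced implicative structure has carrier $\mathfrak{P}(\Pi)$, order $a\preccurlyeq b$ iff $a\supseteq b$ (so its bottom is $\Pi$ and meets are unions), and implication $a\to b=\{t\cdot\pi:t\in a^{\perp\!\!\!\perp},\pi\in b\}$. In an implicative structure, application is $ab=\bigwedge\{c:a\preccurlyeq(b\to c)\}$, abstraction of $f$ is $\bigwedge_a(a\to f(a))$, closed $\lambda$-terms are interpreted as $t^{\mathscr{A}}$ accordingly, and $\mathtt{cc}$ is interpreted by $\bigwedge_{a,b}(((a\to b)\to a)\to a)$. The structure is classically consistent when $t^{\mathscr{A}}\neq\bot$ for all closed $\lambda$-terms with $\mathtt{cc}$. -}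

module Defs where

open import Level using (Level; 0ℓ; _⊔_; Setω) renaming (suc to lsuc)
open import Data.Nat using (ℕ; suc)
open import Data.Fin using (Fin; zero; suc)
open import Data.Product using (Σ; _×_)
open import Relation.Binary.PropositionalEquality using (_≡_)
open import Relation.Nullary using (¬_)

record AKS : Set₁ where
  field
    Λ   : Set
    Π   : Set
    _$_ : Λ → Λ → Λ
    _∙_ : Λ → Π → Π
    k_  : Π → Λ
    K S cc : Λ
    PL  : Λ → Set
    K∈PL  : PL K
    S∈PL  : PL S
    cc∈PL : PL cc
    PL-app : ∀ {t u} → PL t → PL u → PL (t $ u)
    ⊥⊥  : Λ → Π → Set
    ⊥⊥-push : ∀ {t u π} → ⊥⊥ t (u ∙ π) → ⊥⊥ (t $ u) π
    ⊥⊥-K    : ∀ {t u π} → ⊥⊥ t π → ⊥⊥ K (t ∙ (u ∙ π))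
    ⊥⊥-S    : ∀ {t u v π} → ⊥⊥ t (v ∙ ((u $ v) ∙ π)) → ⊥⊥ S (t ∙ (u ∙ (v ∙ π)))
    ⊥⊥-cc   : ∀ {t π} → ⊥⊥ t ((k π) ∙ π) → ⊥⊥ cc (t ∙ π)
    ⊥⊥-k    : ∀ {t π π'} → ⊥⊥ t π → ⊥⊥ (k π) (t ∙ π')

-- Closed λ-terms with the constant cc, in de Bruijn form
-- (Term n = terms with at most n free variables; closed = Term 0).
data Term (n : ℕ) : Set where
  var : Fin n → Term n
  app : Term n → Term n → Term n
  lam : Term (suc n) → Term n
  ccₜ : Term n

-- Universe level at which the interpretation of a term lives
-- (subsets of Π are predicates Π → Set; meets over them raise the level).
lev : ∀ {n} → Term n → Level
lev (var x)   = 0ℓ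
lev (app t u) = lsuc 0ℓ ⊔ lev t ⊔ lev u
lev (lam t)   = lsuc 0ℓ ⊔ lev t
lev ccₜ       = lsuc 0ℓ

module Induced (𝒦 : AKS) where
  open AKS 𝒦

  -- elements of the implicative structure 𝔓(Π)
  Sub : (ℓ : Level) → Set (lsuc ℓ)
  Sub ℓ = Π → Set ℓ

  Env : ℕ → Set₁
  Env n = Fin n → Sub 0ℓ

  _∷ₑ_ : ∀ {n} → Sub 0ℓ → Env n → Env (suc n)
  (a ∷ₑ ρ) zero    = a
  (a ∷ₑ ρ) (suc x) = ρ x

  orth : ∀ {ℓ} → Sub ℓ → Λ → Set ℓ
  orth a t = ∀ π → a π → ⊥⊥ t π

  _≼_ : ∀ {ℓ ℓ'} → Sub ℓ → Sub ℓ' → Set (ℓ ⊔ ℓ')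
  a ≼ b = ∀ π → b π → a π

  _⇒_ : ∀ {ℓ ℓ'} → Sub ℓ → Sub ℓ' → Sub (ℓ ⊔ ℓ')
  (a ⇒ b) ρ = Σ Λ λ t → Σ Π λ π → orth a t × b π × (ρ ≡ t ∙ π)

  ⋀ : ∀ {ℓ ℓ'} {I : Set ℓ} → (I → Sub ℓ') → Sub (ℓ ⊔ ℓ')
  ⋀ {I = I} f π = Σ I λ i → f i π

  appᴬ : ∀ {ℓ ℓ'} → Sub ℓ → Sub ℓ' → Sub (lsuc 0ℓ ⊔ ℓ ⊔ ℓ')
  appᴬ a b π = Σ (Sub 0ℓ) λ c → (a ≼ (b ⇒ c)) × c π

  ccᴬ : Sub (lsuc 0ℓ)
  ccᴬ = ⋀ {I = Sub 0ℓ × Sub 0ℓ} λ p →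
          let a = Data.Product.proj₁ p ; b = Data.Product.proj₂ p in
          (((a ⇒ b) ⇒ a) ⇒ a)

  ⟦_⟧ : ∀ {n} (t : Term n) → Env n → Sub (lev t)
  ⟦ var x ⟧   ρ = ρ x
  ⟦ app t u ⟧ ρ = appᴬ (⟦ t ⟧ ρ) (⟦ u ⟧ ρ)
  ⟦ lam t ⟧   ρ = ⋀ {I = Sub 0ℓ} λ a → a ⇒ ⟦ t ⟧ (a ∷ₑ ρ)
  ⟦ ccₜ ⟧     ρ = ccᴬ

  emptyEnv : Env 0
  emptyEnv ()

  ⟦_⟧₀ : (t : Term 0) → Sub (lev t)
  ⟦ t ⟧₀ = ⟦ t ⟧ emptyEnv

  -- t^𝒜 = Π (= ⊥ of the implicative structure)
  IsTop : ∀ {ℓ} → Sub ℓ → Set ℓ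
  IsTop a = ∀ π → a π

Consistent : AKS → Set
Consistent 𝒦 = ∀ t → PL t → ¬ (∀ π → ⊥⊥ t π)
  where open AKS 𝒦

ClassicallyConsistent : AKS → Setω
ClassicallyConsistent 𝒦 = (t : Term 0) → ¬ IsTop ⟦ t ⟧₀
  where open Induced 𝒦

module Submission where

-- Proof idea (Krivine's adequacy lemma, via bracket abstraction).
--
-- Every λ-term t with n free variables (possibly containing cc) is compiled
-- into a proof-like combinator ⌜t⌝ built from K, S and cc only, such that
-- ⌜t⌝ applied to n arguments behaves on the abstract machine like t with
-- those arguments substituted for its variables.  Because a combinator
-- expecting n+1 arguments already IS the abstraction of one expecting n,
-- the compilation of λ is the identity; variables become projections,
-- application becomes an n-ary S, and cc ignores the n arguments.
--
-- The
-- only semantic ingredient beyond the definitions is that cc realises ccᴬ.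
-- Finally, if ⟦t⟧ were the whole of Π, the proof-like term ⌜t⌝ would lie in
-- Π^⊥⊥, contradicting the consistency of 𝒦.

open import Defs
open import Data.Nat using (ℕ; zero; suc)
open import Data.Fin using (Fin; zero; suc)
open import Data.Vec.Functional using (Vector; _∷_; tail)
open import Data.Product using (_,_)
open import Relation.Binary.PropositionalEquality using (refl)

-- A vector σ of n arguments is pushed with σ zero innermost,
-- so that the de Bruijn variable zero refers to the last argument supplied.
module Combinators (𝒦 : AKS) where
  open AKS 𝒦

  pushAll : ∀ {n} → Vector Λ n → Π → Π
  pushAll {zero}  σ π = π
  pushAll {suc n} σ π = pushAll (tail σ) (σ zero ∙ π)

  applyAll : ∀ {n} → Λ → Vector Λ n → Λ
  applyAll {zero}  c σ = c
  applyAll {suc n} c σ = applyAll c (tail σ) $ σ zero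

  applyAll-⊥⊥ : ∀ {n} c (σ : Vector Λ n) π → ⊥⊥ c (pushAll σ π) → ⊥⊥ (applyAll c σ) π
  applyAll-⊥⊥ {zero}  c σ π h = h
  applyAll-⊥⊥ {suc n} c σ π h = ⊥⊥-push (applyAll-⊥⊥ c (tail σ) (σ zero ∙ π) h)

  I : Λ
  I = (S $ K) $ K

  I-eval : ∀ {u π} → ⊥⊥ u π → ⊥⊥ I (u ∙ π)
  I-eval h = ⊥⊥-push (⊥⊥-push (⊥⊥-S (⊥⊥-K h)))

  Kⁿ : ℕ → Λ → Λ
  Kⁿ zero    c = c
  Kⁿ (suc n) c = Kⁿ n (K $ c)

  Kⁿ-eval : ∀ n c (σ : Vector Λ n) π → ⊥⊥ c π → ⊥⊥ (Kⁿ n c) (pushAll σ π)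
  Kⁿ-eval zero    c σ π h = h
  Kⁿ-eval (suc n) c σ π h =
    Kⁿ-eval n (K $ c) (tail σ) (σ zero ∙ π) (⊥⊥-push (⊥⊥-K h))

  Sⁿ : ℕ → Λ → Λ → Λ
  Sⁿ zero    a b = a $ b
  Sⁿ (suc n) a b = Sⁿ n (Sⁿ n (Kⁿ n S) a) b

  Sⁿ-eval : ∀ n a b (σ : Vector Λ n) π →
            ⊥⊥ a (pushAll σ (applyAll b σ ∙ π)) → ⊥⊥ (Sⁿ n a b) (pushAll σ π)
  Sⁿ-eval zero    a b σ π h = ⊥⊥-push h
  Sⁿ-eval (suc n) a b σ π h =
    Sⁿ-eval n (Sⁿ n (Kⁿ n S) a) b τ (u ∙ π)
      (Sⁿ-eval n (Kⁿ n S) a τ (applyAll b τ ∙ (u ∙ π))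
        (Kⁿ-eval n S τ _ (⊥⊥-S (applyAll-⊥⊥ a τ _ h))))
    where
      τ = tail σ
      u = σ zero

  proj : ∀ {n} → Fin n → Λ
  proj {suc n} zero    = Kⁿ n I
  proj {suc n} (suc x) = Sⁿ n (Kⁿ n K) (proj x)

  proj-eval : ∀ {n} (x : Fin n) (σ : Vector Λ n) π → ⊥⊥ (σ x) π → ⊥⊥ (proj x) (pushAll σ π)
  proj-eval {suc n} zero    σ π h = Kⁿ-eval n I (tail σ) _ (I-eval h)
  proj-eval {suc n} (suc x) σ π h =
    Sⁿ-eval n (Kⁿ n K) (proj x) τ (σ zero ∙ π)
      (Kⁿ-eval n K τ _ (⊥⊥-K (applyAll-⊥⊥ (proj x) τ π (proj-eval x τ π h))))
    where τ = tail σ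

  Kⁿ-PL : ∀ n {c} → PL c → PL (Kⁿ n c)
  Kⁿ-PL zero    p = p
  Kⁿ-PL (suc n) p = Kⁿ-PL n (PL-app K∈PL p)

  Sⁿ-PL : ∀ n {a b} → PL a → PL b → PL (Sⁿ n a b)
  Sⁿ-PL zero    p q = PL-app p q
  Sⁿ-PL (suc n) p q = Sⁿ-PL n (Sⁿ-PL n (Kⁿ-PL n S∈PL) p) q

  proj-PL : ∀ {n} (x : Fin n) → PL (proj x)
  proj-PL {suc n} zero    = Kⁿ-PL n (PL-app (PL-app S∈PL K∈PL) K∈PL)
  proj-PL {suc n} (suc x) = Sⁿ-PL n (Kⁿ-PL n K∈PL) (proj-PL x)

module Compilation (𝒦 : AKS) where
  open AKS 𝒦
  open Combinators 𝒦

  ⌜_⌝ : ∀ {n} → Term n → Λ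
  ⌜_⌝     (var x)   = proj x
  ⌜_⌝ {n} (app t s) = Sⁿ n ⌜ t ⌝ ⌜ s ⌝
  ⌜_⌝     (lam t)   = ⌜ t ⌝
  ⌜_⌝ {n} ccₜ       = Kⁿ n cc

  compile-PL : ∀ {n} (t : Term n) → PL ⌜ t ⌝
  compile-PL     (var x)   = proj-PL x
  compile-PL {n} (app t s) = Sⁿ-PL n (compile-PL t) (compile-PL s)
  compile-PL     (lam t)   = compile-PL t
  compile-PL {n} ccₜ       = Kⁿ-PL n cc∈PL

module Adequacy (𝒦 : AKS) where
  open AKS 𝒦
  open Induced 𝒦
  open Combinators 𝒦
  open Compilation 𝒦

  _⊩_ : ∀ {n} → Vector Λ n → Env n → Set
  σ ⊩ ρ = ∀ x → orth (ρ x) (σ x)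

  ⊩-extend : ∀ {n} {σ : Vector Λ n} {ρ : Env n} {u a} →
             orth a u → σ ⊩ ρ → (u ∷ σ) ⊩ (a ∷ₑ ρ)
  ⊩-extend ou r zero    = ou
  ⊩-extend ou r (suc x) = r x

  -- cc realises ccᴬ = ⋀_{a,b} (((a → b) → a) → a): on a stack t ∙ π with
  -- t ∈ ((a → b) → a)^⊥⊥ and π ∈ a, the continuation k π realises a → b.
  cc-realises-ccᴬ : orth ccᴬ cc
  cc-realises-ccᴬ .(t ∙ π) ((a , b) , t , π , ot , aπ , refl) =
    ⊥⊥-cc (ot ((k π) ∙ π) (k π , π , kπ-realises , aπ , refl))
    where
      kπ-realises : orth (a ⇒ b) (k π)
      kπ-realises .(u ∙ π') (u , π' , ou , bπ' , refl) = ⊥⊥-k (ou π aπ)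

  adequacy : ∀ {n} (t : Term n) {ρ : Env n} {σ : Vector Λ n} → σ ⊩ ρ →
             ∀ π → ⟦ t ⟧ ρ π → ⊥⊥ ⌜ t ⌝ (pushAll σ π)
  adequacy (var x) {σ = σ} r π h = proj-eval x σ π (r x π h)
  adequacy {n} (app t s) {ρ} {σ} r π (c , t≼s⇒c , cπ) =
    Sⁿ-eval n ⌜ t ⌝ ⌜ s ⌝ σ π
      (adequacy t r (s̅ ∙ π) (t≼s⇒c (s̅ ∙ π) (s̅ , π , s̅-realises , cπ , refl)))
    where
      s̅ = applyAll ⌜ s ⌝ σ
      s̅-realises : orth (⟦ s ⟧ ρ) s̅
      s̅-realises π' h = applyAll-⊥⊥ ⌜ s ⌝ σ π' (adequacy s r π' h)
  adequacy (lam t) r .(u ∙ π) (a , u , π , ou , h , refl) =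
    adequacy t (⊩-extend ou r) π h
  adequacy {n} ccₜ {σ = σ} r π h = Kⁿ-eval n cc σ π (cc-realises-ccᴬ π h)

-- A closed term whose interpretation is all of Π would compile to a
-- proof-like term in Π^⊥⊥, which consistency of 𝒦 forbids.
proposition2p38 : (𝒦 : AKS) → Consistent 𝒦 → ClassicallyConsistent 𝒦
proposition2p38 𝒦 consistent t top =
  consistent ⌜ t ⌝ (compile-PL t) (λ π → adequacy t noArguments π (top π))
  where
    open Compilation 𝒦
    open Adequacy 𝒦

    noArguments : (λ ()) ⊩ Induced.emptyEnv 𝒦
    noArguments ()
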